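{- Let $q$ be a prime with $q\equiv 3\pmod 4$. If $(a,b,c,d)$ is a $\{2,q\}$-Diophantine quadruple, then, up to permutation, the residues of $a,b,c,d$ modulo $4$ are $(1,1,3,3)$.
   Context: For a finite set $S$ of primes, a positive integer is an $S$-unit if all its prime factors lie in $S$. A quadruple $(a,b,c,d)$ of positive, pairwise distinct integers is an $S$-Diophantine quadruple if the product of any two distinct entries plus $1$ is an $S$-unit. -}

module Defs where

open import Data.Nat using (ℕ; _+_; _*_; _<_)
open import Data.Nat.Divisibility using (_∣_)
open import Data.Nat.Primality using (Prime)
open import Data.Product using (_×_)
open import Data.Sum using (_⊎_)
open import Data.List using (List; _∷_; [])
open import Relation.Binary.PropositionalEquality using (_≡_; _≢_)

IsUnit2q : ℕ → ℕ → Set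
IsUnit2q q n = (0 < n) × (∀ p → Prime p → p ∣ n → (p ≡ 2) ⊎ (p ≡ q))

IsDiophQuad2q : ℕ → ℕ → ℕ → ℕ → ℕ → Set
IsDiophQuad2q q a b c d =
  (0 < a) × (0 < b) × (0 < c) × (0 < d) ×
  (a ≢ b) × (a ≢ c) × (a ≢ d) × (b ≢ c) × (b ≢ d) × (c ≢ d) ×
  IsUnit2q q (a * b + 1) × IsUnit2q q (a * c + 1) × IsUnit2q q (a * d + 1) ×
  IsUnit2q q (b * c + 1) × IsUnit2q q (b * d + 1) × IsUnit2q q (c * d + 1)

-- Each xy + 1 with x, y in the quadruple is 2^e q^f. Unless the residues of x and y mod 4 are
-- {1, 3}, xy + 1 is not divisible by 4, so e ≤ 1, and xy + 1 > 2 forces q ∣ xy + 1. But q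
-- cannot divide all of xy + 1, xz + 1 and yz + 1: the identity
-- x²(yz + 1) + (xy + 1) + (xz + 1) = (xy + 1)(xz + 1) + (x² + 1) would give q ∣ x² + 1, while for
-- q ≡ 3 (mod 4) this forces x⁴ ≡ 1, so x^(q+1) ≡ 1, and by Fermat x^(q+1) ≡ x² ≡ −1, i.e. q ∣ 2.
-- So every three of a, b, c, d contain a pair with residues {1, 3}, and checking the finitely
-- many residue patterns leaves only 1, 1, 3, 3.

module Submission where

open import Defs
open import Data.Nat
open import Data.Nat.Properties
open import Data.Nat.DivMod
open import Data.Nat.Divisibility
open import Data.Nat.Primality
open import Data.Nat.Primality.Factorisation using (factorise)
open import Data.Nat.Combinatorics
open import Data.Nat.ListAction using (product)
open import Data.Nat.Tactic.RingSolver using (solve-∀)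
open import Data.Fin using (Fin; zero; suc; toℕ; fromℕ)
open import Data.Fin.Properties using (toℕ-fromℕ)
open import Data.Product using (_×_; _,_; ∃-syntax)
open import Data.Sum using (_⊎_; inj₁; inj₂)
open import Data.List using (_∷_; [])
import Data.List.Properties as List
open import Data.List.Relation.Unary.All using (_∷_)
open import Data.List.Relation.Binary.Permutation.Propositional using (_↭_; ↭-sym; ↭-trans; ↭-reflexive)
open import Data.List.Sort.InsertionSort ≤-decTotalOrder using (sort)
open import Data.List.Sort.InsertionSort.Properties ≤-decTotalOrder using (sort-↭)
open import Relation.Nullary using (Dec; yes; no; contradiction)
open import Relation.Nullary.Decidable using (_×-dec_; _⊎-dec_; _→-dec_; from-yes)
open import Relation.Binary.PropositionalEquality
open import Algebra.Properties.CommutativeSemiring.Binomial +-*-commutativeSemiring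
  using (theorem; binomialTerm)
import Algebra.Properties.Semiring.Exp +-*-semiring as Semiring
import Algebra.Definitions.RawMonoid +-0-rawMonoid as Additive

open ≡-Reasoning

module _ {n} .{{_ : NonZero n}} where

  %-cong-+ : ∀ {a b c d} → a % n ≡ b % n → c % n ≡ d % n → (a + c) % n ≡ (b + d) % n
  %-cong-+ {a} {b} {c} {d} a≡b c≡d = begin
    (a + c) % n             ≡⟨ %-distribˡ-+ a c n ⟩
    (a % n + c % n) % n     ≡⟨ cong₂ (λ u v → (u + v) % n) a≡b c≡d ⟩
    (b % n + d % n) % n     ≡⟨ %-distribˡ-+ b d n ⟨
    (b + d) % n             ∎

  %-cong-* : ∀ {a b c d} → a % n ≡ b % n → c % n ≡ d % n → (a * c) % n ≡ (b * d) % n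
  %-cong-* {a} {b} {c} {d} a≡b c≡d = begin
    (a * c) % n             ≡⟨ %-distribˡ-* a c n ⟩
    (a % n * (c % n)) % n   ≡⟨ cong₂ (λ u v → (u * v) % n) a≡b c≡d ⟩
    (b % n * (d % n)) % n   ≡⟨ %-distribˡ-* b d n ⟨
    (b * d) % n             ∎

  %-cong-^ : ∀ {a b} k → a % n ≡ b % n → (a ^ k) % n ≡ (b ^ k) % n
  %-cong-^ zero    a≡b = refl
  %-cong-^ (suc k) a≡b = %-cong-* a≡b (%-cong-^ k a≡b)

  sum%≡last% : ∀ m (t : Fin (suc m) → ℕ) → (∀ k → toℕ k < m → n ∣ t k) →
               Additive.sum t % n ≡ t (fromℕ m) % n
  sum%≡last% zero    t _   = cong (_% n) (+-identityʳ (t zero))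
  sum%≡last% (suc m) t n∣t = trans (%-remove-+ˡ _ (n∣t zero z<s))
    (sum%≡last% m (λ k → t (suc k)) (λ k k<m → n∣t (suc k) (s<s k<m)))

[1+k]*[1+n]C[1+k]≡[1+n]*nCk : ∀ n k → suc k * (suc n C suc k) ≡ suc n * (n C k)
[1+k]*[1+n]C[1+k]≡[1+n]*nCk zero    zero    = refl
[1+k]*[1+n]C[1+k]≡[1+n]*nCk zero    (suc k) = *-zeroʳ (suc (suc k))
[1+k]*[1+n]C[1+k]≡[1+n]*nCk (suc m) zero    =
  trans (*-identityˡ _) (trans (nC1≡n (2 + m)) (sym (*-identityʳ _)))
[1+k]*[1+n]C[1+k]≡[1+n]*nCk n@(suc m) (suc j) = begin
  (2 + j) * (suc n C (2 + j))            ≡⟨ cong ((2 + j) *_) (nCk+nC[k+1]≡[n+1]C[k+1] n (suc j)) ⟨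
  (2 + j) * (A + n C (2 + j))            ≡⟨ split A (n C (2 + j)) ⟩
  A + (1 + j) * A + (2 + j) * (n C (2 + j))
    ≡⟨ cong₂ (λ u v → A + u + v) ([1+k]*[1+n]C[1+k]≡[1+n]*nCk m j)
                                 ([1+k]*[1+n]C[1+k]≡[1+n]*nCk m (suc j)) ⟩
  A + n * (m C j) + n * (m C suc j)      ≡⟨ join A (m C j) (m C suc j) ⟩
  A + n * (m C j + m C suc j)            ≡⟨ cong (λ u → A + n * u) (nCk+nC[k+1]≡[n+1]C[k+1] m j) ⟩
  suc n * A                              ∎
  where
  A : ℕ
  A = n C suc j
  split : ∀ a b → (2 + j) * (a + b) ≡ a + (1 + j) * a + (2 + j) * b
  split = solve-∀
  join : ∀ a c d → a + n * c + n * d ≡ a + n * (c + d)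
  join = solve-∀

prime∣pCk : ∀ {p k} → Prime p → 0 < k → k < p → p ∣ p C k
prime∣pCk {suc n} {suc j} p-prime 0<k k<p
  with euclidsLemma (suc j) (suc n C suc j) p-prime
         (divides (n C j) (trans ([1+k]*[1+n]C[1+k]≡[1+n]*nCk n j) (*-comm (suc n) (n C j))))
... | inj₁ p∣k   = contradiction (∣⇒≤ p∣k) (<⇒≱ k<p)
... | inj₂ p∣pCk = p∣pCk

^-semiring≡^ : ∀ a k → a Semiring.^ k ≡ a ^ k
^-semiring≡^ a zero    = refl
^-semiring≡^ a (suc k) = cong (a *_) (^-semiring≡^ a k)

×-additive≡* : ∀ k a → k Additive.× a ≡ k * a
×-additive≡* zero    a = refl
×-additive≡* (suc k) a = cong (a +_) (×-additive≡* k a)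

module _ {m} (p-prime : Prime (suc m)) where

  private
    p : ℕ
    p = suc m

  freshmans-dream : ∀ a → ((a + 1) ^ p) % p ≡ (1 + a ^ p) % p
  freshmans-dream a = begin
    ((a + 1) ^ p) % p                ≡⟨ cong (_% p) (^-semiring≡^ (a + 1) p) ⟨
    ((a + 1) Semiring.^ p) % p       ≡⟨ cong (_% p) (theorem p a 1) ⟩
    (t zero + Additive.sum (λ k → t (suc k))) % p
      ≡⟨ %-cong-+ {a = t zero} {1} {Additive.sum (λ k → t (suc k))} {t (fromℕ p)}
           (cong (_% p) first≡1) (sum%≡last% m (λ k → t (suc k)) p∣middle) ⟩
    (1 + t (fromℕ p)) % p            ≡⟨ cong (λ u → (1 + u) % p) last≡a^p ⟩
    (1 + a ^ p) % p                  ∎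
    where
    t : Fin (suc p) → ℕ
    t = binomialTerm a 1 p
    term≡ : ∀ k → t k ≡ (p C toℕ k) * (a ^ toℕ k * 1 ^ (p ∸ toℕ k))
    term≡ k = trans (×-additive≡* (p C toℕ k) _)
      (cong₂ (λ u v → (p C toℕ k) * (u * v)) (^-semiring≡^ a (toℕ k)) (^-semiring≡^ 1 (p ∸ toℕ k)))
    first≡1 : t zero ≡ 1
    first≡1 = trans (term≡ zero) (trans (*-identityˡ _) (trans (*-identityˡ _) (^-zeroˡ p)))
    p∣middle : ∀ k → toℕ k < m → p ∣ t (suc k)
    p∣middle k k<m = subst (p ∣_) (sym (term≡ (suc k))) (∣m⇒∣m*n _ (prime∣pCk p-prime z<s (s<s k<m)))
    last≡a^p : t (fromℕ p) ≡ a ^ p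
    last≡a^p = begin
      t (fromℕ p)                                 ≡⟨ term≡ (fromℕ p) ⟩
      (p C toℕ (fromℕ p)) * (a ^ toℕ (fromℕ p) * 1 ^ (p ∸ toℕ (fromℕ p)))
        ≡⟨ cong (λ k → (p C k) * (a ^ k * 1 ^ (p ∸ k))) (toℕ-fromℕ p) ⟩
      (p C p) * (a ^ p * 1 ^ (p ∸ p))
        ≡⟨ cong₂ (λ c e → c * (a ^ p * 1 ^ e)) (nCn≡1 p) (n∸n≡0 p) ⟩
      1 * (a ^ p * 1)                             ≡⟨ trans (*-identityˡ _) (*-identityʳ _) ⟩
      a ^ p                                       ∎

  fermats-little-theorem : ∀ a → (a ^ p) % p ≡ a % p
  fermats-little-theorem zero    = refl
  fermats-little-theorem (suc a) = begin
    (suc a ^ p) % p       ≡⟨ cong (λ b → (b ^ p) % p) (+-comm 1 a) ⟩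
    ((a + 1) ^ p) % p     ≡⟨ freshmans-dream a ⟩
    (1 + a ^ p) % p       ≡⟨ %-cong-+ {a = 1} {1} {a ^ p} {a} refl (fermats-little-theorem a) ⟩
    suc a % p             ∎

p%4≡3⇒p∤x*x+1 : ∀ {p} → Prime p → p % 4 ≡ 3 → ∀ x → p ∤ x * x + 1
p%4≡3⇒p∤x*x+1 {p@(suc _)} p-prime p%4≡3 x p∣x²+1 = contradiction (∣⇒≤ p∣2) (<⇒≱ 2<p)
  where
  y t : ℕ
  y = x * x
  t = p / 4
  x⁴≡y*y : ∀ x → x * (x * (x * (x * 1))) ≡ (x * x) * (x * x)
  x⁴≡y*y = solve-∀
  y*y+y+1≡[y+1]*y+1 : ∀ y → y * y + (y + 1) ≡ (y + 1) * y + 1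
  y*y+y+1≡[y+1]*y+1 = solve-∀
  3+4t+1≡4[t+1] : ∀ t → 3 + t * 4 + 1 ≡ 4 * (t + 1)
  3+4t+1≡4[t+1] = solve-∀
  p≡3+t*4 : p ≡ 3 + t * 4
  p≡3+t*4 = trans (m≡m%n+[m/n]*n p 4) (cong (_+ t * 4) p%4≡3)
  2<p : 2 < p
  2<p = subst (_≤ p) p%4≡3 (m%n≤m p 4)
  x⁴≡1 : (x ^ 4) % p ≡ 1 % p
  x⁴≡1 = begin
    (x ^ 4) % p            ≡⟨ cong (_% p) (x⁴≡y*y x) ⟩
    (y * y) % p            ≡⟨ %-remove-+ʳ (y * y) p∣x²+1 ⟨
    (y * y + (y + 1)) % p  ≡⟨ cong (_% p) (y*y+y+1≡[y+1]*y+1 y) ⟩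
    ((y + 1) * y + 1) % p  ≡⟨ %-remove-+ˡ 1 (∣m⇒∣m*n y p∣x²+1) ⟩
    1 % p                  ∎
  x^[p+1]≡1 : (x ^ (p + 1)) % p ≡ 1 % p
  x^[p+1]≡1 = begin
    (x ^ (p + 1)) % p          ≡⟨ cong (λ e → (x ^ (e + 1)) % p) p≡3+t*4 ⟩
    (x ^ (3 + t * 4 + 1)) % p  ≡⟨ cong (λ e → (x ^ e) % p) (3+4t+1≡4[t+1] t) ⟩
    (x ^ (4 * (t + 1))) % p    ≡⟨ cong (_% p) (^-*-assoc x 4 (t + 1)) ⟨
    ((x ^ 4) ^ (t + 1)) % p    ≡⟨ %-cong-^ (t + 1) x⁴≡1 ⟩
    (1 ^ (t + 1)) % p          ≡⟨ cong (_% p) (^-zeroˡ (t + 1)) ⟩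
    1 % p                      ∎
  x^[p+1]≡y : (x ^ (p + 1)) % p ≡ y % p
  x^[p+1]≡y = begin
    (x ^ (p + 1)) % p      ≡⟨ cong (_% p) (^-distribˡ-+-* x p 1) ⟩
    (x ^ p * x ^ 1) % p    ≡⟨ %-cong-* {a = x ^ p} {x} {x ^ 1} {x}
                                (fermats-little-theorem p-prime x) (cong (_% p) (*-identityʳ x)) ⟩
    y % p                  ∎
  p∣2 : p ∣ 2
  p∣2 = m%n≡0⇒n∣m 2 p (begin
    2 % p          ≡⟨ %-cong-+ {a = 1} {y} {1} {1} (trans (sym x^[p+1]≡1) x^[p+1]≡y) refl ⟩
    (y + 1) % p    ≡⟨ n∣m⇒m%n≡0 (y + 1) p p∣x²+1 ⟩
    0              ∎)

∣-triangle⇒∣x*x+1 : ∀ {q} x y z → q ∣ x * y + 1 → q ∣ x * z + 1 → q ∣ y * z + 1 → q ∣ x * x + 1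
∣-triangle⇒∣x*x+1 {q} x y z q∣xy+1 q∣xz+1 q∣yz+1 = ∣m+n∣m⇒∣n
  (subst (q ∣_) (expand x y z) (∣m∣n⇒∣m+n (∣n⇒∣m*n (x * x) q∣yz+1) (∣m∣n⇒∣m+n q∣xy+1 q∣xz+1)))
  (∣m⇒∣m*n (x * z + 1) q∣xy+1)
  where
  expand : ∀ x y z → x * x * (y * z + 1) + ((x * y + 1) + (x * z + 1))
                   ≡ (x * y + 1) * (x * z + 1) + (x * x + 1)
  expand = solve-∀

∃-prime-divisor : ∀ {n} → 1 < n → ∃[ p ] Prime p × p ∣ n
∃-prime-divisor {n@(suc _)} 1<n with factorise n
... | record { factors = [] ; isFactorisation = n≡1 } = contradiction n≡1 (>⇒≢ 1<n)
... | record { factors = p ∷ ps ; isFactorisation = n≡p*Πps ; factorsPrime = p-prime ∷ _ } =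
  p , p-prime , divides (product ps) (trans n≡p*Πps (*-comm p (product ps)))

2∤1+k*2 : ∀ k → 2 ∤ 1 + k * 2
2∤1+k*2 k 2∣1+2k = contradiction (trans (sym ([m+kn]%n≡m%n 1 k 2)) (n∣m⇒m%n≡0 _ 2 2∣1+2k)) λ ()

n%4≡1+k*2⇒2∤n : ∀ {n} k → n % 4 ≡ 1 + k * 2 → 2 ∤ n
n%4≡1+k*2⇒2∤n k n%4≡1+2k 2∣n = 2∤1+k*2 k (subst (2 ∣_) n%4≡1+2k (%-presˡ-∣ 2∣n (divides 2 refl)))

odd-divisor⇒q∣unit : ∀ {q n m} → IsUnit2q q n → m ∣ n → 2 ∤ m → 1 < m → q ∣ n
odd-divisor⇒q∣unit (_ , 2-or-q) m∣n 2∤m 1<m with ∃-prime-divisor 1<m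
... | p , p-prime , p∣m with 2-or-q p p-prime (∣-trans p∣m m∣n)
...   | inj₁ refl = contradiction p∣m 2∤m
...   | inj₂ refl = ∣-trans p∣m m∣n

n%4≢0⇒q∣unit : ∀ {q n} → IsUnit2q q n → n % 4 ≢ 0 → 2 < n → q ∣ n
n%4≢0⇒q∣unit {q} {n} u n%4≢0 2<n with n % 4 in n%4≡r
... | 0 = contradiction refl n%4≢0
... | 1 = odd-divisor⇒q∣unit u ∣-refl (n%4≡1+k*2⇒2∤n 0 n%4≡r) (<-trans (s<s z<s) 2<n)
... | 3 = odd-divisor⇒q∣unit u ∣-refl (n%4≡1+k*2⇒2∤n 1 n%4≡r) (<-trans (s<s z<s) 2<n)
... | 2 = odd-divisor⇒q∣unit u (divides 2 n≡2*m) (2∤1+k*2 k) (*-cancelˡ-< 2 1 m (subst (2 <_) n≡2*m 2<n))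
  where
  k m : ℕ
  k = n / 4
  m = 1 + k * 2
  n≡2*m : n ≡ 2 * m
  n≡2*m = trans (m≡m%n+[m/n]*n n 4) (trans (cong (_+ k * 4) n%4≡r) (2+k*4≡2*[1+k*2] k))
    where
    2+k*4≡2*[1+k*2] : ∀ k → 2 + k * 4 ≡ 2 * (1 + k * 2)
    2+k*4≡2*[1+k*2] = solve-∀
... | suc (suc (suc (suc _))) =
  contradiction (subst (_< 4) n%4≡r (m%n<n n 4)) λ { (s<s (s<s (s<s (s<s ())))) }

Opposite : ℕ → ℕ → Set
Opposite r s = (r ≡ 1 × s ≡ 3) ⊎ (r ≡ 3 × s ≡ 1)

opposite? : ∀ r s → Dec (Opposite r s)
opposite? r s = (r ≟ 1 ×-dec s ≟ 3) ⊎-dec (r ≟ 3 ×-dec s ≟ 1)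

OppositeOrDivides : ℕ → ℕ → ℕ → Set
OppositeOrDivides q x y = Opposite (x % 4) (y % 4) ⊎ q ∣ x * y + 1

HasOpposite : ℕ → ℕ → ℕ → Set
HasOpposite r s t = Opposite r s ⊎ Opposite r t ⊎ Opposite s t

hasOpposite? : ∀ r s t → Dec (HasOpposite r s t)
hasOpposite? r s t = opposite? r s ⊎-dec opposite? r t ⊎-dec opposite? s t

4∣r*s+1⇒opposite : ∀ {r} → r < 4 → ∀ {s} → s < 4 → (r * s + 1) % 4 ≡ 0 → Opposite r s
4∣r*s+1⇒opposite = from-yes (allUpTo? (λ r → allUpTo? (λ s →
  ((r * s + 1) % 4 ≟ 0) →-dec opposite? r s) 4) 4)

x≢y⇒1<x*y : ∀ {x y} → 0 < x → 0 < y → x ≢ y → 1 < x * y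
x≢y⇒1<x*y {1} {1} _ _ x≢y = contradiction refl x≢y
x≢y⇒1<x*y {1} {suc (suc y)} _ _ _ = s<s (s<s z≤n)
x≢y⇒1<x*y {suc (suc x)} {y@(suc _)} _ _ _ = ≤-trans (s<s (s<s z≤n)) (m≤m*n (2 + x) y)

opposite⊎q∣x*y+1 : ∀ {q x y} → 0 < x → 0 < y → x ≢ y → IsUnit2q q (x * y + 1) →
                   OppositeOrDivides q x y
opposite⊎q∣x*y+1 {x = x} {y} 0<x 0<y x≢y u with (x * y + 1) % 4 ≟ 0
... | yes 4∣ = inj₁ (4∣r*s+1⇒opposite (m%n<n x 4) (m%n<n y 4) (trans residues 4∣))
  where
  residues : (x % 4 * (y % 4) + 1) % 4 ≡ (x * y + 1) % 4
  residues = %-cong-+ {a = x % 4 * (y % 4)} {x * y} {1} {1}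
    (%-cong-* {a = x % 4} {x} {y % 4} {y} (m%n%n≡m%n x 4) (m%n%n≡m%n y 4)) refl
... | no 4∤ = inj₂ (n%4≢0⇒q∣unit u 4∤ (+-monoˡ-< 1 (x≢y⇒1<x*y 0<x 0<y x≢y)))

opposite-in-triple : ∀ {q} → Prime q → q % 4 ≡ 3 → ∀ x y z →
  OppositeOrDivides q x y → OppositeOrDivides q x z → OppositeOrDivides q y z →
  HasOpposite (x % 4) (y % 4) (z % 4)
opposite-in-triple _ _ _ _ _ (inj₁ xy) _ _ = inj₁ xy
opposite-in-triple _ _ _ _ _ (inj₂ _) (inj₁ xz) _ = inj₂ (inj₁ xz)
opposite-in-triple _ _ _ _ _ (inj₂ _) (inj₂ _) (inj₁ yz) = inj₂ (inj₂ yz)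
opposite-in-triple q-prime q%4≡3 x y z (inj₂ q∣xy+1) (inj₂ q∣xz+1) (inj₂ q∣yz+1) =
  contradiction (∣-triangle⇒∣x*x+1 x y z q∣xy+1 q∣xz+1 q∣yz+1) (p%4≡3⇒p∤x*x+1 q-prime q%4≡3 x)

-- Phrased through sort so that the claim is decidable; it is checked by evaluation.
sort-residues≡1133 : ∀ {ra} → ra < 4 → ∀ {rb} → rb < 4 → ∀ {rc} → rc < 4 → ∀ {rd} → rd < 4 →
  HasOpposite ra rb rc → HasOpposite ra rb rd → HasOpposite ra rc rd → HasOpposite rb rc rd →
  sort (ra ∷ rb ∷ rc ∷ rd ∷ []) ≡ 1 ∷ 1 ∷ 3 ∷ 3 ∷ []
sort-residues≡1133 = from-yes (allUpTo? (λ ra → allUpTo? (λ rb → allUpTo? (λ rc → allUpTo? (λ rd →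
  hasOpposite? ra rb rc →-dec hasOpposite? ra rb rd →-dec
  hasOpposite? ra rc rd →-dec hasOpposite? rb rc rd →-dec
  List.≡-dec _≟_ (sort (ra ∷ rb ∷ rc ∷ rd ∷ [])) (1 ∷ 1 ∷ 3 ∷ 3 ∷ [])) 4) 4) 4) 4)

lemma5 : (q : ℕ) → Prime q → q % 4 ≡ 3 →
    (a b c d : ℕ) → IsDiophQuad2q q a b c d →
    (a % 4 ∷ b % 4 ∷ c % 4 ∷ d % 4 ∷ []) ↭ (1 ∷ 1 ∷ 3 ∷ 3 ∷ [])
lemma5 q q-prime q%4≡3 a b c d
  (0<a , 0<b , 0<c , 0<d , a≢b , a≢c , a≢d , b≢c , b≢d , c≢d , ab , ac , ad , bc , bd , cd) =
  ↭-trans (↭-sym (sort-↭ _)) (↭-reflexive (sort-residues≡1133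
    (m%n<n a 4) (m%n<n b 4) (m%n<n c 4) (m%n<n d 4)
    (opposite-in-triple q-prime q%4≡3 a b c a-b a-c b-c)
    (opposite-in-triple q-prime q%4≡3 a b d a-b a-d b-d)
    (opposite-in-triple q-prime q%4≡3 a c d a-c a-d c-d)
    (opposite-in-triple q-prime q%4≡3 b c d b-c b-d c-d)))
  where
  a-b : OppositeOrDivides q a b
  a-b = opposite⊎q∣x*y+1 0<a 0<b a≢b ab
  a-c : OppositeOrDivides q a c
  a-c = opposite⊎q∣x*y+1 0<a 0<c a≢c ac
  a-d : OppositeOrDivides q a d
  a-d = opposite⊎q∣x*y+1 0<a 0<d a≢d ad
  b-c : OppositeOrDivides q b c
  b-c = opposite⊎q∣x*y+1 0<b 0<c b≢c bc
  b-d : OppositeOrDivides q b d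
  b-d = opposite⊎q∣x*y+1 0<b 0<d b≢d bd
  c-d : OppositeOrDivides q c d
  c-d = opposite⊎q∣x*y+1 0<c 0<d c≢d cd
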